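{- Consider the following greedy procedure for matching in a trapezoid graph given by a trapezoid diagram. For each trapezoid $T(i)$ define its right spread $f(i) = \max\{b(i), d(i)\}$ and sort the trapezoids by $f$ in ascending order. Start with $M = \emptyset$. While at least two vertices remain: let $i$ be the remaining vertex with minimum $f(i)$; scan the other remaining vertices $j$ in ascending order of $f(j)$ and take the first one adjacent to $i$; if such $j$ exists, add the edge $(i,j)$ to $M$ and delete $i$ and $j$ from the graph; otherwise delete $i$ from the graph. Output $M$. Then there exists a trapezoid graph (on four vertices) for which the output $M$ is not a maximum matching; in fact there is a four-trapezoid diagram with $f(1) < f(2) < f(3) < f(4)$ in which all pairs of trapezoids intersect except $T(3)$ and $T(4)$, on which the procedure outputs a matching of size $1$ while the maximum matching has size $2$.
   Context: A trapezoid diagram consists of two parallel horizontal lines and a set of trapezoids $T(i)$, each with upper left, upper right, lower left and lower right corner points $a(i) < b(i)$ (on the upper line) and $c(i) < d(i)$ (on the lower line); no two trapezoids share a common endpoint. The trapezoid graph has one vertex per trapezoid, with two vertices adjacent iff the corresponding trapezoids intersect. A matching is a set of pairwise non-adjacent edges (no shared endpoints); a maximum matching is a matching of largest cardinality. Deleting a vertex removes it and all its incident edges. -}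

module Defs where

open import Data.Nat using (ℕ)
open import Data.Fin using (Fin)
open import Data.Rational using (ℚ; 0ℚ; 1ℚ; _+_; _*_; _-_; _≤_; _<_; _⊔_)
open import Data.Product using (_×_; _,_; Σ; ∃; ∃-syntax; proj₁; proj₂)
open import Data.Sum using (_⊎_; inj₁; inj₂; [_,_])
open import Data.List using (List; []; _∷_; _++_; concatMap)
open import Data.List.Relation.Unary.All using (All)
open import Data.List.Relation.Unary.Unique.Propositional using (Unique)
open import Relation.Binary.PropositionalEquality using (_≡_; _≢_)
open import Relation.Nullary using (¬_)
open import Function.Definitions using (Injective)

-- A trapezoid diagram with n trapezoids T(0) … T(n-1).
-- The upper line is y = 0, the lower line is y = 1; coordinates are rational.
record TrapezoidDiagram (n : ℕ) : Set where
  field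
    a b c d : Fin n → ℚ
    a<b : ∀ i → a i < b i
    c<d : ∀ i → c i < d i
    -- no two trapezoids share a common endpoint: all 2n upper endpoints
    -- are pairwise distinct, and all 2n lower endpoints are pairwise distinct
    upper-distinct : Injective _≡_ _≡_ (λ (e : Fin n ⊎ Fin n) → [ a , b ] e)
    lower-distinct : Injective _≡_ _≡_ (λ (e : Fin n ⊎ Fin n) → [ c , d ] e)

module _ {n : ℕ} (D : TrapezoidDiagram n) where
  open TrapezoidDiagram D

  -- The point (x , y) lies in the trapezoid T(i) (the convex hull of its four
  -- corners (a i , 0), (b i , 0), (c i , 1), (d i , 1)).
  InTrapezoid : Fin n → ℚ → ℚ → Set
  InTrapezoid i x y =
    (0ℚ ≤ y) × (y ≤ 1ℚ) ×
    (((1ℚ - y) * a i + y * c i) ≤ x) × (x ≤ ((1ℚ - y) * b i + y * d i))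

  Intersect : Fin n → Fin n → Set
  Intersect i j = ∃[ x ] ∃[ y ] (InTrapezoid i x y × InTrapezoid j x y)

  Adj : Fin n → Fin n → Set
  Adj i j = (i ≢ j) × Intersect i j

  f : Fin n → ℚ
  f i = b i ⊔ d i

-- Matchings in a graph with vertex set V and adjacency relation Adj,
-- represented as a list of edges; its size is the length of the list.
endpoints : {V : Set} → List (V × V) → List V
endpoints = concatMap (λ e → proj₁ e ∷ proj₂ e ∷ [])

IsMatching : {V : Set} → (V → V → Set) → List (V × V) → Set
IsMatching Adj M = All (λ e → Adj (proj₁ e) (proj₂ e)) M × Unique (endpoints M)

-- The greedy procedure, as a relation  Greedy Adj L M :  run on the graph whose
-- remaining vertices, listed in ascending order of f, are L, it outputs M.
data Greedy {V : Set} (Adj : V → V → Set) : List V → List (V × V) → Set where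
  stop0 : Greedy Adj [] []
  stop1 : ∀ v → Greedy Adj (v ∷ []) []
  match : ∀ i pre j post M →
          All (λ k → ¬ Adj i k) pre → Adj i j →
          Greedy Adj (pre ++ post) M →
          Greedy Adj (i ∷ pre ++ j ∷ post) ((i , j) ∷ M)
  skip  : ∀ i r rest M →
          All (λ k → ¬ Adj i k) (r ∷ rest) →
          Greedy Adj (r ∷ rest) M →
          Greedy Adj (i ∷ r ∷ rest) M

-- The diagram has upper intervals [2,6], [3,7], [1,4], [5,9] and lower intervals
-- [1,10], [2,11], [12,13], [14,15], so f = 10, 11, 13, 15.  T(3) lies strictly to the
-- left of T(4) on both lines, hence (by convexity) everywhere; every other pair
-- shares the point 3 or the point 5 of the upper line.  The greedy procedure is
-- deterministic: it first matches T(1) with T(2), its first neighbour in f-order,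
-- and is then left with the non-adjacent pair T(3), T(4).  Yet {T(1)T(3), T(2)T(4)}
-- is a matching of size 2, and no matching on 4 vertices is larger.
module Submission where

open import Defs
open import Data.Nat using (ℕ; _≤_)
import Data.Nat as ℕ
import Data.Nat.Properties as ℕ
open import Data.Integer using (+_; ∣_∣)
open import Data.Rational as ℚ using (ℚ; 0ℚ; 1ℚ; _<_; _/_; _-_; -_; ↥_; positive; nonNegative)
import Data.Rational.Properties as ℚ
open import Data.Fin using (Fin; zero; suc)
import Data.Fin as Fin
open import Data.Fin.Properties using (injective⇒≤)
open import Data.Product using (_×_; _,_; ∃-syntax; proj₂)
open import Data.Sum using (_⊎_; inj₁; inj₂; [_,_])
open import Data.List using (List; []; _∷_; _++_; length; lookup; allFin)
open import Data.List.Properties using (∷-injective; ++-conicalʳ)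
open import Data.List.Membership.Propositional.Properties using (∈-lookup)
open import Data.List.Relation.Unary.All using (All; []; _∷_)
import Data.List.Relation.Unary.All as All
open import Data.List.Relation.Unary.All.Properties using (++⁻ʳ)
open import Data.List.Relation.Unary.Unique.Propositional using (Unique; _∷_)
open import Data.List.Relation.Unary.Unique.DecPropositional (Fin._≟_ {4}) using (unique?)
open import Function using (_∘_)
open import Function.Definitions using (Injective)
open import Function.Consequences.Propositional using (inverseʳ⇒injective; strictlyInverseʳ⇒inverseʳ)
open import Relation.Binary.PropositionalEquality using (_≡_; refl; sym; trans; cong; cong₂; subst)
open import Relation.Nullary using (¬_; yes; no; contradiction)
open import Relation.Nullary.Decidable using (True; toWitness)

module _ {A : Set} {P : A → Set} where

  All¬-++-∷ : ∀ pre {j post} → All (λ k → ¬ P k) (pre ++ j ∷ post) → ¬ P j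
  All¬-++-∷ pre ¬ps with ++⁻ʳ pre ¬ps
  ... | ¬pj ∷ _ = ¬pj

  first-satisfying-unique :
    ∀ pre {j post} pre′ {j′ post′} →
    All (λ k → ¬ P k) pre → P j → All (λ k → ¬ P k) pre′ → P j′ →
    pre ++ j ∷ post ≡ pre′ ++ j′ ∷ post′ →
    pre ≡ pre′ × j ≡ j′ × post ≡ post′
  first-satisfying-unique [] [] _ _ _ _ refl = refl , refl , refl
  first-satisfying-unique [] (_ ∷ _) _ pj (¬pk ∷ _) _ refl = contradiction pj ¬pk
  first-satisfying-unique (_ ∷ _) [] (¬pk ∷ _) _ _ pj′ refl = contradiction pj′ ¬pk
  first-satisfying-unique (_ ∷ pre) (_ ∷ pre′) (_ ∷ ¬ps) pj (_ ∷ ¬ps′) pj′ eq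
    with ∷-injective eq
  ... | refl , eq′ with first-satisfying-unique pre pre′ ¬ps pj ¬ps′ pj′ eq′
  ... | refl , refl , refl = refl , refl , refl

module _ {V : Set} {Adj : V → V → Set} where

  Greedy-functional : ∀ {L L′ M M′} → Greedy Adj L M → Greedy Adj L′ M′ → L ≡ L′ → M ≡ M′
  Greedy-functional stop0 stop0 _ = refl
  Greedy-functional (stop1 _) (stop1 _) _ = refl
  Greedy-functional (stop1 _) (match _ pre _ _ _ _ _ _) eq =
    contradiction (++-conicalʳ pre _ (sym (∷-injective eq .proj₂))) λ ()
  Greedy-functional (match _ pre _ _ _ _ _ _) (stop1 _) eq =
    contradiction (++-conicalʳ pre _ (∷-injective eq .proj₂)) λ ()
  Greedy-functional (match i pre j _ _ ¬pre adj g) (match _ pre′ _ _ _ ¬pre′ adj′ g′) eq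
    with ∷-injective eq
  ... | refl , eq′ with first-satisfying-unique pre pre′ ¬pre adj ¬pre′ adj′ eq′
  ... | refl , refl , refl = cong ((i , j) ∷_) (Greedy-functional g g′ refl)
  Greedy-functional (match _ pre _ _ _ _ adj _) (skip _ _ _ _ ¬rest _) eq with ∷-injective eq
  ... | refl , eq′ = contradiction adj (All¬-++-∷ pre (subst (All _) (sym eq′) ¬rest))
  Greedy-functional (skip _ _ _ _ ¬rest _) (match _ pre _ _ _ _ adj _) eq with ∷-injective eq
  ... | refl , eq′ = contradiction adj (All¬-++-∷ pre (subst (All _) eq′ ¬rest))
  Greedy-functional (skip _ _ _ _ _ g) (skip _ _ _ _ _ g′) eq =
    Greedy-functional g g′ (∷-injective eq .proj₂)

Unique-lookup-injective : ∀ {A : Set} {xs : List A} → Unique xs →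
                          ∀ {i j} → lookup xs i ≡ lookup xs j → i ≡ j
Unique-lookup-injective (_ ∷ _) {zero} {zero} _ = refl
Unique-lookup-injective (x∉xs ∷ _) {zero} {suc j} eq = contradiction eq (All.lookup x∉xs (∈-lookup j))
Unique-lookup-injective (x∉xs ∷ _) {suc i} {zero} eq = contradiction (sym eq) (All.lookup x∉xs (∈-lookup i))
Unique-lookup-injective (_ ∷ u) {suc i} {suc j} eq = cong suc (Unique-lookup-injective u eq)

Unique⇒length≤ : ∀ {n} {xs : List (Fin n)} → Unique xs → length xs ≤ n
Unique⇒length≤ u = injective⇒≤ (Unique-lookup-injective u)

length-endpoints : ∀ {V : Set} (M : List (V × V)) → length (endpoints M) ≡ 2 ℕ.* length M
length-endpoints [] = refl
length-endpoints (_ ∷ M) = trans (cong (2 ℕ.+_) (length-endpoints M)) (sym (ℕ.*-suc 2 (length M)))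

matching-length-bound : ∀ {n} {Adj : Fin n → Fin n → Set} {M : List (Fin n × Fin n)} →
                        IsMatching Adj M → 2 ℕ.* length M ≤ n
matching-length-bound {M = M} (_ , u) =
  subst (_≤ _) (length-endpoints M) (Unique⇒length≤ u)

by-computation : ∀ {p q} {t : True (p ℚ.<? q)} → p < q
by-computation {t = t} = toWitness t

-- The sides of T(i) at height y, as they appear in InTrapezoid, are
-- interpolate y (a i) (c i) and interpolate y (b i) (d i).
interpolate : ℚ → ℚ → ℚ → ℚ
interpolate y p q = (1ℚ - y) ℚ.* p ℚ.+ y ℚ.* q

interpolate-zero : ∀ p q → interpolate 0ℚ p q ≡ p
interpolate-zero p q =
  trans (cong₂ ℚ._+_ (ℚ.*-identityˡ p) (ℚ.*-zeroˡ q)) (ℚ.+-identityʳ p)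

interpolate-mono-< : ∀ {y p p′ q q′} → 0ℚ ℚ.≤ y → y ℚ.≤ 1ℚ → p < p′ → q < q′ →
                     interpolate y p q < interpolate y p′ q′
interpolate-mono-< {y} 0≤y y≤1 p<p′ q<q′ with y ℚ.<? 1ℚ
... | yes y<1 =
  ℚ.+-mono-<-≤ (ℚ.*-monoʳ-<-pos (1ℚ - y) {{positive 0<1-y}} p<p′)
               (ℚ.*-monoˡ-≤-nonNeg y {{nonNegative 0≤y}} (ℚ.<⇒≤ q<q′))
  where
  0<1-y : 0ℚ < 1ℚ - y
  0<1-y = subst (_< 1ℚ - y) (ℚ.+-inverseʳ y) (ℚ.+-monoˡ-< (- y) y<1)
... | no y≮1 =
  ℚ.+-mono-≤-< (ℚ.*-monoˡ-≤-nonNeg (1ℚ - y) {{nonNegative 0≤1-y}} (ℚ.<⇒≤ p<p′))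
               (ℚ.*-monoʳ-<-pos y {{positive 0<y}} q<q′)
  where
  0≤1-y : 0ℚ ℚ.≤ 1ℚ - y
  0≤1-y = subst (ℚ._≤ 1ℚ - y) (ℚ.+-inverseʳ y) (ℚ.+-monoˡ-≤ (- y) y≤1)
  0<y : 0ℚ < y
  0<y = ℚ.<-≤-trans by-computation (ℚ.≮⇒≥ y≮1)

module _ {n : ℕ} (D : TrapezoidDiagram n) where
  open TrapezoidDiagram D

  separated⇒¬Intersect : ∀ {i j} → b i < a j → d i < c j → ¬ Intersect D i j
  separated⇒¬Intersect bi<aj di<cj (x , y , (0≤y , y≤1 , _ , x≤right-i) , (_ , _ , left-j≤x , _)) =
    ℚ.<-irrefl refl
      (ℚ.<-≤-trans (interpolate-mono-< 0≤y y≤1 bi<aj di<cj) (ℚ.≤-trans left-j≤x x≤right-i))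

  on-upper-line : ∀ {i x} → a i ℚ.≤ x → x ℚ.≤ b i → InTrapezoid D i x 0ℚ
  on-upper-line {i} ai≤x x≤bi =
    ( ℚ.≤-refl , ℚ.<⇒≤ by-computation
    , subst (ℚ._≤ _) (sym (interpolate-zero (a i) (c i))) ai≤x
    , subst (_ ℚ.≤_) (sym (interpolate-zero (b i) (d i))) x≤bi )

  meet-on-upper-line : ∀ {i j} x → a i ℚ.≤ x → x ℚ.≤ b i → a j ℚ.≤ x → x ℚ.≤ b j → Intersect D i j
  meet-on-upper-line x ai≤x x≤bi aj≤x x≤bj =
    x , 0ℚ , on-upper-line ai≤x x≤bi , on-upper-line aj≤x x≤bj

toℚ : ℕ → ℚ
toℚ n = + n / 1

pattern t₁ = zero
pattern t₂ = suc zero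
pattern t₃ = suc (suc zero)
pattern t₄ = suc (suc (suc zero))

a₀ b₀ c₀ d₀ : Fin 4 → ℕ
a₀ t₁ = 2
a₀ t₂ = 3
a₀ t₃ = 1
a₀ t₄ = 5
b₀ t₁ = 6
b₀ t₂ = 7
b₀ t₃ = 4
b₀ t₄ = 9
c₀ t₁ = 1
c₀ t₂ = 2
c₀ t₃ = 12
c₀ t₄ = 14
d₀ t₁ = 10
d₀ t₂ = 11
d₀ t₃ = 13
d₀ t₄ = 15

upper-owner lower-owner : ℕ → Fin 4 ⊎ Fin 4
upper-owner 2 = inj₁ t₁
upper-owner 3 = inj₁ t₂
upper-owner 1 = inj₁ t₃
upper-owner 5 = inj₁ t₄
upper-owner 6 = inj₂ t₁
upper-owner 7 = inj₂ t₂
upper-owner 4 = inj₂ t₃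
upper-owner _ = inj₂ t₄
lower-owner 1 = inj₁ t₁
lower-owner 2 = inj₁ t₂
lower-owner 12 = inj₁ t₃
lower-owner 14 = inj₁ t₄
lower-owner 10 = inj₂ t₁
lower-owner 11 = inj₂ t₂
lower-owner 13 = inj₂ t₃
lower-owner _ = inj₂ t₄

upper-endpoint lower-endpoint : Fin 4 ⊎ Fin 4 → ℚ
upper-endpoint = [ toℚ ∘ a₀ , toℚ ∘ b₀ ]
lower-endpoint = [ toℚ ∘ c₀ , toℚ ∘ d₀ ]

upper-endpoint-injective : Injective _≡_ _≡_ upper-endpoint
upper-endpoint-injective =
  inverseʳ⇒injective upper-endpoint (strictlyInverseʳ⇒inverseʳ {f⁻¹ = upper-owner ∘ ∣_∣ ∘ ↥_} upper-endpoint λ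
    { (inj₁ t₁) → refl ; (inj₁ t₂) → refl ; (inj₁ t₃) → refl ; (inj₁ t₄) → refl
    ; (inj₂ t₁) → refl ; (inj₂ t₂) → refl ; (inj₂ t₃) → refl ; (inj₂ t₄) → refl })

lower-endpoint-injective : Injective _≡_ _≡_ lower-endpoint
lower-endpoint-injective =
  inverseʳ⇒injective lower-endpoint (strictlyInverseʳ⇒inverseʳ {f⁻¹ = lower-owner ∘ ∣_∣ ∘ ↥_} lower-endpoint λ
    { (inj₁ t₁) → refl ; (inj₁ t₂) → refl ; (inj₁ t₃) → refl ; (inj₁ t₄) → refl
    ; (inj₂ t₁) → refl ; (inj₂ t₂) → refl ; (inj₂ t₃) → refl ; (inj₂ t₄) → refl })

counterexample : TrapezoidDiagram 4
counterexample = record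
  { a = toℚ ∘ a₀ ; b = toℚ ∘ b₀ ; c = toℚ ∘ c₀ ; d = toℚ ∘ d₀
  ; a<b = λ { t₁ → by-computation ; t₂ → by-computation ; t₃ → by-computation ; t₄ → by-computation }
  ; c<d = λ { t₁ → by-computation ; t₂ → by-computation ; t₃ → by-computation ; t₄ → by-computation }
  ; upper-distinct = upper-endpoint-injective
  ; lower-distinct = lower-endpoint-injective
  }

meet-at : ∀ i j x
  {ai≤x : True (toℚ (a₀ i) ℚ.≤? x)} {x≤bi : True (x ℚ.≤? toℚ (b₀ i))}
  {aj≤x : True (toℚ (a₀ j) ℚ.≤? x)} {x≤bj : True (x ℚ.≤? toℚ (b₀ j))} →
  Intersect counterexample i j
meet-at i j x {ai≤x} {x≤bi} {aj≤x} {x≤bj} =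
  meet-on-upper-line counterexample {i} {j} x (toWitness ai≤x) (toWitness x≤bi) (toWitness aj≤x) (toWitness x≤bj)

intersect-unless-T₃T₄ : ∀ i j → ¬ (i ≡ t₃ × j ≡ t₄) → ¬ (i ≡ t₄ × j ≡ t₃) → Intersect counterexample i j
intersect-unless-T₃T₄ t₃ t₄ ¬34 _ = contradiction (refl , refl) ¬34
intersect-unless-T₃T₄ t₄ t₃ _ ¬43 = contradiction (refl , refl) ¬43
intersect-unless-T₃T₄ t₁ t₁ _ _ = meet-at t₁ t₁ (toℚ 3)
intersect-unless-T₃T₄ t₁ t₂ _ _ = meet-at t₁ t₂ (toℚ 3)
intersect-unless-T₃T₄ t₁ t₃ _ _ = meet-at t₁ t₃ (toℚ 3)
intersect-unless-T₃T₄ t₁ t₄ _ _ = meet-at t₁ t₄ (toℚ 5)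
intersect-unless-T₃T₄ t₂ t₁ _ _ = meet-at t₂ t₁ (toℚ 3)
intersect-unless-T₃T₄ t₂ t₂ _ _ = meet-at t₂ t₂ (toℚ 3)
intersect-unless-T₃T₄ t₂ t₃ _ _ = meet-at t₂ t₃ (toℚ 3)
intersect-unless-T₃T₄ t₂ t₄ _ _ = meet-at t₂ t₄ (toℚ 5)
intersect-unless-T₃T₄ t₃ t₁ _ _ = meet-at t₃ t₁ (toℚ 3)
intersect-unless-T₃T₄ t₃ t₂ _ _ = meet-at t₃ t₂ (toℚ 3)
intersect-unless-T₃T₄ t₃ t₃ _ _ = meet-at t₃ t₃ (toℚ 3)
intersect-unless-T₃T₄ t₄ t₁ _ _ = meet-at t₄ t₁ (toℚ 5)
intersect-unless-T₃T₄ t₄ t₂ _ _ = meet-at t₄ t₂ (toℚ 5)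
intersect-unless-T₃T₄ t₄ t₄ _ _ = meet-at t₄ t₄ (toℚ 5)

¬Intersect-T₃T₄ : ¬ Intersect counterexample t₃ t₄
¬Intersect-T₃T₄ = separated⇒¬Intersect counterexample {t₃} {t₄} by-computation by-computation

T₁~T₂ : Adj counterexample t₁ t₂
T₁~T₂ = (λ ()) , meet-at t₁ t₂ (toℚ 3)

greedy-run : Greedy (Adj counterexample) (allFin 4) ((t₁ , t₂) ∷ [])
greedy-run =
  match t₁ [] t₂ (t₃ ∷ t₄ ∷ []) [] [] T₁~T₂
    (skip t₃ t₄ [] [] ((¬Intersect-T₃T₄ ∘ proj₂) ∷ []) (stop1 t₄))

greedy-matching : IsMatching (Adj counterexample) ((t₁ , t₂) ∷ [])
greedy-matching = T₁~T₂ ∷ [] , toWitness {a? = unique? _} _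

perfect-matching : IsMatching (Adj counterexample) ((t₁ , t₃) ∷ (t₂ , t₄) ∷ [])
perfect-matching =
  ((λ ()) , meet-at t₁ t₃ (toℚ 3)) ∷ ((λ ()) , meet-at t₂ t₄ (toℚ 5)) ∷ [] ,
  toWitness {a? = unique? _} _

mainTheorem2 : ∃[ D ]
    ((f {4} D zero < f D (suc zero)) ×
    (f D (suc zero) < f D (suc (suc zero))) ×
    (f D (suc (suc zero)) < f D (suc (suc (suc zero))))) ×
    ((∀ (i j : Fin 4) → ¬ (i ≡ suc (suc zero) × j ≡ suc (suc (suc zero)))
    → ¬ (i ≡ suc (suc (suc zero)) × j ≡ suc (suc zero))
    → Intersect D i j) ×
    ¬ Intersect D (suc (suc zero)) (suc (suc (suc zero)))) ×
    (∃[ M ] Greedy (Adj D) (allFin 4) M) ×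
    (∀ M → Greedy (Adj D) (allFin 4) M → IsMatching (Adj D) M × length M ≡ 1) ×
    (∃[ N ] IsMatching (Adj D) N × length N ≡ 2) ×
    (∀ N → IsMatching (Adj D) N → length N ≤ 2)
mainTheorem2 =
  counterexample ,
  (by-computation , by-computation , by-computation) ,
  (intersect-unless-T₃T₄ , ¬Intersect-T₃T₄) ,
  (_ , greedy-run) ,
  (λ M run → subst (λ M → IsMatching _ M × length M ≡ 1)
                   (Greedy-functional greedy-run run refl) (greedy-matching , refl)) ,
  (_ , perfect-matching , refl) ,
  (λ N matching → ℕ.*-cancelˡ-≤ 2 (matching-length-bound matching))
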